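{- Let $n\geqslant 5$, let $\phi$ be an automorphism of $\text{CQ}_n$, and let $u,v\in V(\text{CQ}_n)$ with $\phi(u)=v$. Then for each $k\in\{0,1\}$, $\phi$ maps the $k$th neighbor of $u$ to the $k$th neighbor of $v$.
   Context: Two 2-bit strings $x_2x_1$ and $y_2y_1$ are pair related, written $x_2x_1\sim y_2y_1$, iff $(x_2x_1,y_2y_1)\in\{(00,00),(10,10),(01,11),(11,01)\}$. The $n$-dimensional crossed cube $\text{CQ}_n$ has as vertices all binary strings $u=u_{n-1}\ldots u_0$ of length $n$. For $0\leqslant x\leqslant n-1$, a vertex $v$ is the $x$th neighbor of $u$ iff: (1) $v_x\neq u_x$; (2) if $x$ is odd, $v_{x-1}=u_{x-1}$; (3) $v_i=u_i$ for all $i>x$; (4) $u_{2i+1}u_{2i}\sim v_{2i+1}v_{2i}$ for all $0\leqslant i\leqslant\lfloor x/2\rfloor-1$ (each vertex has exactly one $x$th neighbor). Two vertices are adjacent iff one is the $x$th neighbor of the other for some $x$. -}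

module Defs where

open import Data.Bool using (Bool; true; false)
open import Data.Nat using (ℕ; zero; suc; _+_; _*_; _<_; _≥_)
open import Data.Nat.Base using (_%_)
open import Data.Vec using (Vec; lookup)
open import Data.Fin using (Fin; toℕ)
open import Data.Product using (_×_; ∃-syntax; _,_)
open import Data.Sum using (_⊎_)
open import Relation.Binary.PropositionalEquality using (_≡_; _≢_)
open import Function.Bundles using (Bijection; _⤖_; _⇔_)

-- A vertex u = u_{n-1} ... u_0 is a vector; position i holds the bit u_i.
Vertex : ℕ → Set
Vertex n = Vec Bool n

-- bit i of a vertex (only used with i < n; returns false out of range)
bit : ∀ {n} → Vec Bool n → ℕ → Bool
bit {zero} u i = false
bit {suc n} u i = lookupℕ u i
  where
  lookupℕ : ∀ {m} → Vec Bool m → ℕ → Bool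
  lookupℕ Vec.[] _ = false
  lookupℕ (b Vec.∷ bs) zero = b
  lookupℕ (b Vec.∷ bs) (suc j) = lookupℕ bs j

data PairRel : Bool → Bool → Bool → Bool → Set where
  p00 : PairRel false false false false
  p10 : PairRel true false true false
  p01 : PairRel false true true true
  p11 : PairRel true true false true

IsNbr : ∀ {n} → ℕ → Vertex n → Vertex n → Set
IsNbr {n} x u v =
  (x < n)
  × (bit v x ≢ bit u x)
  × (x % 2 ≡ 1 → bit v (x Data.Nat.∸ 1) ≡ bit u (x Data.Nat.∸ 1))
  × (∀ i → x < i → i < n → bit v i ≡ bit u i)
  -- 0 ≤ i ≤ ⌊x/2⌋ - 1  ⇔  2i + 2 ≤ x  ⇔  2i + 1 < x
  × (∀ i → 2 * i + 1 < x →
       PairRel (bit u (2 * i + 1)) (bit u (2 * i)) (bit v (2 * i + 1)) (bit v (2 * i)))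

Adj : ∀ {n} → Vertex n → Vertex n → Set
Adj {n} u v = ∃[ x ] (IsNbr x u v ⊎ IsNbr x v u)

record Automorphism (n : ℕ) : Set where
  field
    bij : Vertex n ⤖ Vertex n
  φ : Vertex n → Vertex n
  φ = Bijection.to bij
  field
    preserves : ∀ u v → Adj u v ⇔ Adj (φ u) (φ v)

-- Write nbr x u for the x-th neighbour of u. An edge of dimension 0 lies on exactly one 4-cycle,
-- the one closed by the 1-neighbours of its ends. An edge of dimension x ≠ 0 lies on at least two:
-- once n ≥ 4 there are two further dimensions y with nbr x ∘ nbr y = nbr y ∘ nbr x, and each
-- closes a 4-cycle. Automorphisms preserve 4-cycles, so they map 0-edges to 0-edges, and then the
-- unique 4-cycle on a 0-edge to the unique 4-cycle on its image, which pins down the 1-neighbour.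
module Submission where

open import Defs
open import Data.Bool using (Bool; true; false; not; _xor_)
open import Data.Bool.Properties using (not-involutive; not-¬; ¬-not; xor-assoc; xor-same; xor-identityʳ; not-distribˡ-xor; not-distribʳ-xor)
open import Data.Nat using (ℕ; zero; suc; _+_; _*_; _∸_; _<_; _≤_; _≥_; _%_; z≤n; s≤s; z<s; s<s)
open import Data.Nat.Properties using (*-suc; +-cancelˡ-<; +-comm; *-comm; <-cmp; <⇒≤; ≤-trans; <-≤-trans; <-trans; n<1+n; 1+n≢n; <⇒≱; m<1+n⇒m≤n; m+n∸n≡m)
open import Data.Nat.DivMod using ([m+kn]%n≡m%n)
open import Data.Vec using (Vec; []; _∷_)
open import Data.Vec.Properties using (∷-injectiveˡ; ∷-injectiveʳ)
open import Data.Product using (_×_; _,_; proj₁; proj₂; ∃-syntax)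
open import Data.Sum using (_⊎_; inj₁; inj₂)
open import Relation.Binary.Definitions using (tri<; tri≈; tri>)
open import Relation.Binary.PropositionalEquality
open import Relation.Nullary using (contradiction)
open import Function.Bundles using (Bijection; Equivalence)

xor-cancelʳ : ∀ a b → (a xor b) xor b ≡ a
xor-cancelʳ a b = trans (xor-assoc a b b) (trans (cong (a xor_) (xor-same b)) (xor-identityʳ a))

-- Vectors list u₀ first, and u₂ᵢ₊₁u₂ᵢ ∼ v₂ᵢ₊₁v₂ᵢ says exactly
-- (v₂ᵢ₊₁ , v₂ᵢ) = (u₂ᵢ₊₁ xor u₂ᵢ , u₂ᵢ).
-- An out-of-range x leaves the vector unchanged.
nbr : ∀ {m} → ℕ → Vec Bool m → Vec Bool m
nbr x [] = []
nbr zero (b ∷ bs) = not b ∷ bs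
nbr (suc x) (b ∷ []) = b ∷ []
nbr 1 (b₀ ∷ b₁ ∷ bs) = b₀ ∷ not b₁ ∷ bs
nbr (suc (suc x)) (b₀ ∷ b₁ ∷ bs) = b₀ ∷ (b₁ xor b₀) ∷ nbr x bs

PairRel-xor : ∀ a b → PairRel a b (a xor b) b
PairRel-xor false false = p00
PairRel-xor true false = p10
PairRel-xor false true = p01
PairRel-xor true true = p11

PairRel-functional : ∀ {a b c d c′ d′} → PairRel a b c d → PairRel a b c′ d′ → c ≡ c′ × d ≡ d′
PairRel-functional p00 p00 = refl , refl
PairRel-functional p10 p10 = refl , refl
PairRel-functional p01 p01 = refl , refl
PairRel-functional p11 p11 = refl , refl

bit-∷ : ∀ {m} b (v : Vec Bool m) i → bit (b ∷ v) (suc i) ≡ bit v i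
bit-∷ b [] i = refl
bit-∷ b (c ∷ v) i = refl

bit-∷∷ : ∀ {m} a b (v : Vec Bool m) i → bit (a ∷ b ∷ v) (2 + i) ≡ bit v i
bit-∷∷ a b v i = trans (bit-∷ a (b ∷ v) (suc i)) (bit-∷ b v i)

bit-ext : ∀ {m} {v w : Vec Bool m} → (∀ i → i < m → bit v i ≡ bit w i) → v ≡ w
bit-ext {v = []} {[]} _ = refl
bit-ext {v = a ∷ v} {b ∷ w} agree = cong₂ _∷_ (agree 0 z<s) (bit-ext λ i i<m →
  trans (sym (bit-∷ a v i)) (trans (agree (suc i) (s<s i<m)) (bit-∷ b w i)))

bit-nbr-self : ∀ {m} x (u : Vec Bool m) → x < m → bit (nbr x u) x ≡ not (bit u x)
bit-nbr-self zero (b ∷ bs) _ = refl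
bit-nbr-self (suc x) (b ∷ []) (s<s ())
bit-nbr-self 1 (b₀ ∷ b₁ ∷ bs) _ = refl
bit-nbr-self (suc (suc x)) (b₀ ∷ b₁ ∷ bs) (s<s (s<s x<m)) =
  trans (bit-∷∷ b₀ (b₁ xor b₀) (nbr x bs) x)
    (trans (bit-nbr-self x bs x<m) (cong not (sym (bit-∷∷ b₀ b₁ bs x))))

bit-nbr-above : ∀ {m} x (u : Vec Bool m) i → x < i → bit (nbr x u) i ≡ bit u i
bit-nbr-above x [] i _ = refl
bit-nbr-above zero (b ∷ bs) (suc i) _ = refl
bit-nbr-above (suc x) (b ∷ []) i _ = refl
bit-nbr-above 1 (b₀ ∷ b₁ ∷ bs) (suc zero) (s<s ())
bit-nbr-above 1 (b₀ ∷ b₁ ∷ bs) (suc (suc i)) _ = refl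
bit-nbr-above (suc (suc x)) (b₀ ∷ b₁ ∷ bs) (suc (suc i)) (s<s (s<s x<i)) =
  trans (bit-∷∷ b₀ (b₁ xor b₀) (nbr x bs) i)
    (trans (bit-nbr-above x bs i x<i) (sym (bit-∷∷ b₀ b₁ bs i)))

bit-nbr-odd : ∀ {m} x (u : Vec Bool m) → x % 2 ≡ 1 → bit (nbr x u) (x ∸ 1) ≡ bit u (x ∸ 1)
bit-nbr-odd x [] _ = refl
bit-nbr-odd (suc x) (b ∷ []) _ = refl
bit-nbr-odd 1 (b₀ ∷ b₁ ∷ bs) _ = refl
bit-nbr-odd (suc (suc (suc x))) (b₀ ∷ b₁ ∷ bs) odd =
  trans (bit-∷∷ b₀ (b₁ xor b₀) (nbr (suc x) bs) x)
    (trans (bit-nbr-odd (suc x) bs odd) (sym (bit-∷∷ b₀ b₁ bs x)))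

bit-nbr-suc-0 : ∀ {m} x (u : Vec Bool m) → bit (nbr (suc x) u) 0 ≡ bit u 0
bit-nbr-suc-0 x [] = refl
bit-nbr-suc-0 x (b ∷ []) = refl
bit-nbr-suc-0 zero (b₀ ∷ b₁ ∷ bs) = refl
bit-nbr-suc-0 (suc x) (b₀ ∷ b₁ ∷ bs) = refl

PairedAt : ∀ {m} → ℕ → Vec Bool m → Vec Bool m → Set
PairedAt i u v = PairRel (bit u (2 * i + 1)) (bit u (2 * i)) (bit v (2 * i + 1)) (bit v (2 * i))

PairedAt-∷∷ : ∀ {m} i a b c d {u v : Vec Bool m} →
  PairedAt i u v → PairedAt (suc i) (a ∷ b ∷ u) (c ∷ d ∷ v)
PairedAt-∷∷ i a b c d {u} {v} p =
  subst₂ (λ x y → PairRel x y _ _) (sym (odd-bit a b u)) (sym (even-bit a b u))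
    (subst₂ (PairRel _ _) (sym (odd-bit c d v)) (sym (even-bit c d v)) p)
  where
  even-bit : ∀ a b (w : Vec Bool _) → bit (a ∷ b ∷ w) (2 * suc i) ≡ bit w (2 * i)
  even-bit a b w = trans (cong (bit (a ∷ b ∷ w)) (*-suc 2 i)) (bit-∷∷ a b w (2 * i))
  odd-bit : ∀ a b (w : Vec Bool _) → bit (a ∷ b ∷ w) (2 * suc i + 1) ≡ bit w (2 * i + 1)
  odd-bit a b w = trans (cong (λ k → bit (a ∷ b ∷ w) (k + 1)) (*-suc 2 i)) (bit-∷∷ a b w (2 * i + 1))

bit-nbr-paired : ∀ {m} x i (u : Vec Bool m) → 2 * i + 1 < x → x < m → PairedAt i u (nbr x u)
bit-nbr-paired 1 zero _ (s<s ()) _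
bit-nbr-paired 1 (suc i) _ (s<s ()) _
bit-nbr-paired (suc (suc x)) zero (b₀ ∷ b₁ ∷ bs) _ _ = PairRel-xor b₁ b₀
bit-nbr-paired (suc (suc x)) (suc i) (b₀ ∷ b₁ ∷ bs) 2i+3<x+2 (s<s (s<s x<m)) =
  PairedAt-∷∷ i b₀ b₁ b₀ (b₁ xor b₀) (bit-nbr-paired x i bs 2i+1<x x<m)
  where
  2i+1<x : 2 * i + 1 < x
  2i+1<x = +-cancelˡ-< 2 _ _ (subst (λ k → k + 1 < 2 + x) (*-suc 2 i) 2i+3<x+2)
bit-nbr-paired (suc (suc x)) i (b ∷ []) _ (s<s ())

nbr-IsNbr : ∀ {n} x (u : Vertex n) → x < n → IsNbr x u (nbr x u)
nbr-IsNbr x u x<n =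
  x<n , flips , bit-nbr-odd x u , (λ i x<i _ → bit-nbr-above x u i x<i) ,
  λ i 2i+1<x → bit-nbr-paired x i u 2i+1<x x<n
  where
  flips : bit (nbr x u) x ≢ bit u x
  flips eq = not-¬ refl (trans (sym eq) (bit-nbr-self x u x<n))

even-or-odd : ∀ i → ∃[ j ] (i ≡ 2 * j ⊎ i ≡ 2 * j + 1)
even-or-odd zero = 0 , inj₁ refl
even-or-odd (suc i) with even-or-odd i
... | j , inj₁ refl = j , inj₂ (+-comm 1 (2 * j))
... | j , inj₂ refl = suc j , inj₁ (trans (cong suc (+-comm (2 * j) 1)) (sym (*-suc 2 j)))

2*j+1%2≡1 : ∀ j → (2 * j + 1) % 2 ≡ 1
2*j+1%2≡1 j = trans (cong (_% 2) (trans (+-comm (2 * j) 1) (cong suc (*-comm 2 j)))) ([m+kn]%n≡m%n 1 j 2)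

IsNbr-unique : ∀ {n} {x} {u v w : Vertex n} → IsNbr x u v → IsNbr x u w → v ≡ w
IsNbr-unique {n} {x} {v = v} {w} (_ , flipᵛ , oddᵛ , aboveᵛ , pairedᵛ)
                                (_ , flipʷ , oddʷ , aboveʷ , pairedʷ) = bit-ext agree
  where
  agree : ∀ i → i < n → bit v i ≡ bit w i
  agree i i<n with <-cmp i x
  ... | tri≈ _ refl _ = trans (¬-not flipᵛ) (sym (¬-not flipʷ))
  ... | tri> _ _ x<i = trans (aboveᵛ i x<i i<n) (sym (aboveʷ i x<i i<n))
  ... | tri< i<x _ _ with even-or-odd i
  ...   | j , inj₂ refl = proj₁ (PairRel-functional (pairedᵛ j i<x) (pairedʷ j i<x))
  ...   | j , inj₁ refl with <-cmp (2 * j + 1) x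
  ...     | tri< 2j+1<x _ _ = proj₂ (PairRel-functional (pairedᵛ j 2j+1<x) (pairedʷ j 2j+1<x))
  ...     | tri≈ _ refl _ = subst (λ k → bit v k ≡ bit w k) (m+n∸n≡m (2 * j) 1)
                              (trans (oddᵛ (2*j+1%2≡1 j)) (sym (oddʷ (2*j+1%2≡1 j))))
  ...     | tri> _ _ x<2j+1 =
    contradiction (m<1+n⇒m≤n (subst (x <_) (+-comm (2 * j) 1) x<2j+1)) (<⇒≱ i<x)

IsNbr⇒nbr : ∀ {n x} {u v : Vertex n} → IsNbr x u v → v ≡ nbr x u
IsNbr⇒nbr {x = x} {u} h = IsNbr-unique h (nbr-IsNbr x u (proj₁ h))

nbr-involutive : ∀ {m} x (v : Vec Bool m) → nbr x (nbr x v) ≡ v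
nbr-involutive x [] = refl
nbr-involutive zero (b ∷ bs) = cong (_∷ bs) (not-involutive b)
nbr-involutive (suc x) (b ∷ []) = refl
nbr-involutive 1 (b₀ ∷ b₁ ∷ bs) = cong (λ c → b₀ ∷ c ∷ bs) (not-involutive b₁)
nbr-involutive (suc (suc x)) (b₀ ∷ b₁ ∷ bs) =
  cong₂ (λ c w → b₀ ∷ c ∷ w) (xor-cancelʳ b₁ b₀) (nbr-involutive x bs)

nbr-≢ : ∀ {m} x (v : Vec Bool m) → x < m → nbr x v ≢ v
nbr-≢ x v x<m eq = not-¬ refl (trans (cong (λ w → bit w x) (sym eq)) (bit-nbr-self x v x<m))

nbr-<-≢ : ∀ {m x y} (v : Vec Bool m) → x < y → y < m → nbr x v ≢ nbr y v
nbr-<-≢ {x = x} {y} v x<y y<m eq =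
  not-¬ refl (trans (sym (bit-nbr-above x v y x<y))
               (trans (cong (λ w → bit w y) eq) (bit-nbr-self y v y<m)))

nbr-injectiveˡ : ∀ {m x y} (v : Vec Bool m) → x < m → y < m → nbr x v ≡ nbr y v → x ≡ y
nbr-injectiveˡ {x = x} {y} v x<m y<m eq with <-cmp x y
... | tri< x<y _ _ = contradiction eq (nbr-<-≢ v x<y y<m)
... | tri≈ _ x≡y _ = x≡y
... | tri> _ _ y<x = contradiction (sym eq) (nbr-<-≢ v y<x x<m)

Commute : ℕ → ℕ → Set
Commute x y = ∀ {m} (v : Vec Bool m) → nbr x (nbr y v) ≡ nbr y (nbr x v)

Commute-sym : ∀ {x y} → Commute x y → Commute y x
Commute-sym comm v = sym (comm v)

nbr-comm-suc : ∀ k → Commute k (suc k)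
nbr-comm-suc k [] = refl
nbr-comm-suc zero (b ∷ []) = refl
nbr-comm-suc zero (b₀ ∷ b₁ ∷ bs) = refl
nbr-comm-suc (suc k) (b ∷ []) = refl
nbr-comm-suc 1 (b₀ ∷ b₁ ∷ bs) = cong (λ c → b₀ ∷ c ∷ nbr 0 bs) (not-distribˡ-xor b₁ b₀)
nbr-comm-suc (suc (suc k)) (b₀ ∷ b₁ ∷ bs) =
  cong (λ w → b₀ ∷ ((b₁ xor b₀) xor b₀) ∷ w) (nbr-comm-suc k bs)

nbr-comm-1 : ∀ x → Commute 1 x
nbr-comm-1 x [] = refl
nbr-comm-1 zero (b ∷ []) = refl
nbr-comm-1 (suc x) (b ∷ []) = refl
nbr-comm-1 zero (b₀ ∷ b₁ ∷ bs) = refl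
nbr-comm-1 1 (b₀ ∷ b₁ ∷ bs) = refl
nbr-comm-1 (suc (suc x)) (b₀ ∷ b₁ ∷ bs) = cong (λ c → b₀ ∷ c ∷ nbr x bs) (not-distribˡ-xor b₁ b₀)

-- Bit 0 forces z = 0; then bit 1 forces y = 0, and the higher bits force x = 0.
nbr-square-through-0 : ∀ {m} x y z (u : Vec Bool m) → suc x < m →
  nbr (suc y) (nbr 0 u) ≡ nbr z (nbr (suc x) u) → x ≡ 0
nbr-square-through-0 zero y z u _ _ = refl
nbr-square-through-0 (suc x) y z (b ∷ []) (s<s ()) _
nbr-square-through-0 (suc x) y (suc z) u@(b₀ ∷ b₁ ∷ bs) _ eq =
  contradiction (trans (sym (bit-nbr-suc-0 z (nbr (suc (suc x)) u)))
                  (trans (cong (λ w → bit w 0) (sym eq)) (bit-nbr-suc-0 y (nbr 0 u))))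
    (not-¬ refl)
nbr-square-through-0 (suc x) zero zero (b₀ ∷ b₁ ∷ bs) (s<s (s<s x<m)) eq =
  contradiction (∷-injectiveʳ (∷-injectiveʳ eq)) (≢-sym (nbr-≢ x bs x<m))
nbr-square-through-0 (suc x) (suc y) zero (b₀ ∷ b₁ ∷ bs) _ eq =
  contradiction (trans (not-distribʳ-xor b₁ b₀) (∷-injectiveˡ (∷-injectiveʳ eq))) (≢-sym (not-¬ refl))

Adj-nbr : ∀ {n x} (u : Vertex n) → x < n → Adj u (nbr x u)
Adj-nbr {x = x} u x<n = x , inj₁ (nbr-IsNbr x u x<n)

Adj⇒nbr : ∀ {n} {u v : Vertex n} → Adj u v → ∃[ x ] x < n × v ≡ nbr x u
Adj⇒nbr (x , inj₁ h) = x , proj₁ h , IsNbr⇒nbr h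
Adj⇒nbr {v = v} (x , inj₂ h) =
  x , proj₁ h , trans (sym (nbr-involutive x v)) (cong (nbr x) (sym (IsNbr⇒nbr h)))

-- u, a, b, u′ form a 4-cycle through the edge u u′.
Square : ∀ {n} → Vertex n → Vertex n → Vertex n → Vertex n → Set
Square u u′ a b = Adj u a × Adj u′ b × Adj a b × a ≢ u′ × b ≢ u

square-on-0-edge-unique : ∀ {n} {u a b : Vertex n} → Square u (nbr 0 u) a b → a ≡ nbr 1 u
square-on-0-edge-unique {u = u} (ua , u′b , ab , a≢u′ , b≢u)
  with Adj⇒nbr ua | Adj⇒nbr u′b | Adj⇒nbr ab
... | zero , _ , refl | _ | _ = contradiction refl a≢u′
... | _ | zero , _ , refl | _ = contradiction (nbr-involutive 0 u) b≢u
... | suc x , x<n , refl | suc y , _ , refl | z , _ , b≡ =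
  cong (λ k → nbr (suc k) u) (nbr-square-through-0 x y z u x<n b≡)

commuting-square : ∀ {n x y} (u : Vertex n) → x < n → y < n → x ≢ y → Commute x y →
  Square u (nbr x u) (nbr y u) (nbr y (nbr x u))
commuting-square {x = x} {y} u x<n y<n x≢y comm =
  Adj-nbr u y<n , Adj-nbr (nbr x u) y<n , subst (Adj (nbr y u)) (comm u) (Adj-nbr (nbr y u) x<n) ,
  (λ eq → x≢y (sym (nbr-injectiveˡ u y<n x<n eq))) ,
  (λ eq → x≢y (nbr-injectiveˡ u x<n y<n
                 (trans (sym (nbr-involutive y (nbr x u))) (cong (nbr y) eq))))

CommutingDirection : ℕ → ℕ → ℕ → Set
CommutingDirection n x y = y < n × x ≢ y × Commute x y

two-commuting-directions : ∀ {n x} → 4 ≤ n → suc x < n →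
  ∃[ y₁ ] ∃[ y₂ ] y₁ ≢ y₂ × CommutingDirection n (suc x) y₁ × CommutingDirection n (suc x) y₂
two-commuting-directions {x = zero} 4≤n _ =
  0 , 2 , (λ ()) , (<-≤-trans z<s 4≤n , (λ ()) , Commute-sym (nbr-comm-suc 0)) ,
                   (<-≤-trans (s<s (s<s z<s)) 4≤n , (λ ()) , nbr-comm-1 2)
two-commuting-directions {x = 1} 4≤n _ =
  1 , 3 , (λ ()) , (<-≤-trans (s<s z<s) 4≤n , (λ ()) , Commute-sym (nbr-comm-1 2)) ,
                   (<-≤-trans (s<s (s<s (s<s z<s))) 4≤n , (λ ()) , nbr-comm-suc 2)
two-commuting-directions {x = suc (suc k)} 4≤n x<n =
  suc (suc k) , 1 , (λ ()) ,
    (<-trans (n<1+n _) x<n , 1+n≢n , Commute-sym (nbr-comm-suc (suc (suc k)))) ,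
    (<-≤-trans (s<s z<s) 4≤n , (λ ()) , Commute-sym (nbr-comm-1 _))

module _ {n} (A : Automorphism n) where
  open Automorphism A
  open Bijection bij using (strictlySurjective) renaming (to⁻ to φ⁻¹)

  φ-φ⁻¹ : ∀ v → φ (φ⁻¹ v) ≡ v
  φ-φ⁻¹ v = proj₂ (strictlySurjective v)

  φ-Adj : ∀ {u v} → Adj u v → Adj (φ u) (φ v)
  φ-Adj {u} {v} = Equivalence.to (preserves u v)

  Adj-φ : ∀ {u v} → Adj (φ u) (φ v) → Adj u v
  Adj-φ {u} {v} = Equivalence.from (preserves u v)

  φ⁻¹-Square : ∀ {u u′ a b} → Square (φ u) (φ u′) a b → Square u u′ (φ⁻¹ a) (φ⁻¹ b)
  φ⁻¹-Square {u} {u′} {a} {b} sq with subst₂ (Square (φ u) (φ u′)) (sym (φ-φ⁻¹ a)) (sym (φ-φ⁻¹ b)) sq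
  ... | ua , u′b , ab , a≢u′ , b≢u =
    Adj-φ ua , Adj-φ u′b , Adj-φ ab , (λ eq → a≢u′ (cong φ eq)) , (λ eq → b≢u (cong φ eq))

  square-on-φ-0-edge-unique : ∀ {u w a b} → w ≡ φ (nbr 0 u) → Square (φ u) w a b → a ≡ φ (nbr 1 u)
  square-on-φ-0-edge-unique {a = a} refl sq =
    trans (sym (φ-φ⁻¹ a)) (cong φ (square-on-0-edge-unique (φ⁻¹-Square sq)))

  φ-nbr-0 : 4 ≤ n → ∀ u → φ (nbr 0 u) ≡ nbr 0 (φ u)
  φ-nbr-0 4≤n u with Adj⇒nbr (φ-Adj (Adj-nbr u (<-≤-trans z<s 4≤n)))
  ... | zero , _ , φu′≡ = φu′≡
  ... | suc x , x<n , φu′≡ with two-commuting-directions 4≤n x<n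
  ...   | y₁ , y₂ , y₁≢y₂ , d₁ , d₂ =
    contradiction
      (nbr-injectiveˡ (φ u) (proj₁ d₁) (proj₁ d₂) (trans (opposite d₁) (sym (opposite d₂)))) y₁≢y₂
    where
    opposite : ∀ {y} → CommutingDirection n (suc x) y → nbr y (φ u) ≡ φ (nbr 1 u)
    opposite (y<n , x≢y , comm) =
      square-on-φ-0-edge-unique (sym φu′≡) (commuting-square (φ u) x<n y<n x≢y comm)

  φ-nbr-1 : 4 ≤ n → ∀ u → φ (nbr 1 u) ≡ nbr 1 (φ u)
  φ-nbr-1 4≤n u = sym (square-on-φ-0-edge-unique (sym (φ-nbr-0 4≤n u))
    (commuting-square (φ u) (<-≤-trans z<s 4≤n) (<-≤-trans (s<s z<s) 4≤n) (λ ()) (nbr-comm-suc 0)))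

  φ-nbr-<2 : 4 ≤ n → ∀ {k} → k < 2 → ∀ u → φ (nbr k u) ≡ nbr k (φ u)
  φ-nbr-<2 4≤n {0} _ = φ-nbr-0 4≤n
  φ-nbr-<2 4≤n {1} _ = φ-nbr-1 4≤n
  φ-nbr-<2 4≤n {suc (suc k)} (s<s (s<s ()))

lemma14 : (n : ℕ) → n ≥ 5 → (A : Automorphism n) → (u v : Vertex n) →
    Automorphism.φ A u ≡ v →
    (k : ℕ) → k < 2 → (w : Vertex n) → IsNbr k u w → IsNbr k v (Automorphism.φ A w)
lemma14 n n≥5 A u v φu≡v k k<2 w w-nbr =
  subst₂ (IsNbr k) φu≡v (sym φw≡nbr) (nbr-IsNbr k (φ u) k<n)
  where
  open Automorphism A using (φ)
  4≤n : 4 ≤ n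
  4≤n = <⇒≤ n≥5
  k<n : k < n
  k<n = <-≤-trans k<2 (≤-trans (s≤s (s≤s z≤n)) 4≤n)
  φw≡nbr : φ w ≡ nbr k (φ u)
  φw≡nbr = trans (cong φ (IsNbr⇒nbr w-nbr)) (φ-nbr-<2 A 4≤n k<2 u)
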